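{- Let $t\geq 2$ be an even integer and let $c\geq 1$. For every choice of integers $b_2,b_4,\ldots,b_{t-2}\geq 0$ there exists a standard linear realization of $$L=\{1^{t-1},2^{b_2},4^{b_4},6^{b_6},\ldots,(t-2)^{b_{t-2}},t^c\}.$$
   Context: The notation $\{1^{a_1},\ldots,t^{a_t}\}$ denotes the multiset with $a_i$ copies of $i$. For a list (multiset) $L$ of positive integers with $|L|$ elements, a linear realization of $L$ is an ordering $[x_0,\ldots,x_{|L|}]$ of $\{0,1,\ldots,|L|\}$ such that the multiset $\{|x_i-x_{i+1}|:0\le i\le |L|-1\}$ equals $L$; it is standard if $x_0=0$. -}

module Defs where

open import Data.Nat using (ℕ; zero; suc; _+_; _*_; _∸_)
open import Data.List using (List; []; _∷_; length; upTo; replicate; concatMap; map; _++_)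
open import Data.List.Relation.Binary.Permutation.Propositional using (_↭_)
open import Data.Product using (_×_)
open import Data.Empty using (⊥)
open import Relation.Binary.PropositionalEquality using (_≡_)

absDiff : ℕ → ℕ → ℕ
absDiff x y = (x ∸ y) + (y ∸ x)

diffs : List ℕ → List ℕ
diffs [] = []
diffs (x ∷ []) = []
diffs (x ∷ y ∷ xs) = absDiff x y ∷ diffs (y ∷ xs)

-- xs is a linear realization of the list (multiset) L:
-- xs is an ordering of {0,1,...,|L|} and the multiset of consecutive
-- absolute differences equals L (multiset equality = permutation).
LinearRealization : List ℕ → List ℕ → Set
LinearRealization L xs = (xs ↭ upTo (suc (length L))) × (diffs xs ↭ L)

StartsWithZero : List ℕ → Set
StartsWithZero [] = ⊥
StartsWithZero (x ∷ _) = x ≡ 0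

StandardLinearRealization : List ℕ → List ℕ → Set
StandardLinearRealization L xs = LinearRealization L xs × StartsWithZero xs

-- The list {1^(t-1), 2^{b_2}, 4^{b_4}, ..., (t-2)^{b_{t-2}}, t^c}
-- with t = 2k; b i is the multiplicity b_{2i} of the element 2i (1 ≤ i ≤ k-1).
theList : (k : ℕ) → (b : ℕ → ℕ) → (c : ℕ) → List ℕ
theList k b c =
  replicate (2 * k ∸ 1) 1
  ++ concatMap (λ i → replicate (b i) (2 * i)) (map suc (upTo (k ∸ 1)))
  ++ replicate c (2 * k)

module Submission where

-- List the multiplicities of the even values from the top, μ_k = c and
-- μ_j = b_{2j} for j < k, and write μ_j = 2⌊μ_j/2⌋ + (μ_j mod 2).
-- 1. Zigzag.  Let R be the heights j with μ_j odd.  The zigzag rise through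
--    {0, …, 2k + |R| - 1} climbs by ones, jumps up by 2j₁, runs down by ones,
--    jumps down by 2j₂, … (j₁ > j₂ > ⋯ the elements of R); its steps are 2k - 1
--    ones and one jump 2j per j ∈ R.  Every jump leaves from a value whose
--    parity differs from that of the top, so the k top rungs {m - 2i - 1, m - 2i}
--    (m the top, i < k) are consecutive entries: the zigzag is a ladder of width k.
-- 2. Climbing.  Splicing m + 1, m + 2 into the lowest rung of a ladder of width
--    w on {0, …, m} adds two jumps 2w and gives a ladder of width w on
--    {0, …, m + 2}.  Climbing ⌊μ_j/2⌋ times at width j, for j = k, …, 1, adds
--    all remaining pairs of jumps.
-- 3. A ladder is a standard realization of its multiset of steps, which is
--    rearranged into the required list.

open import Defs
open import Data.Nat using (ℕ; zero; suc; _+_; _*_; _∸_; _≤_; _<_; z≤n; s≤s; ⌊_/2⌋)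
import Data.Nat.Properties as ℕₚ
open import Data.List
  using (List; []; _∷_; _++_; [_]; map; length; upTo; downFrom; applyUpTo; applyDownFrom; replicate; concatMap)
import Data.List.Properties as Listₚ
open import Data.List.Relation.Binary.Permutation.Propositional
  using (_↭_; prep; swap; ↭-refl; ↭-sym; ↭-trans; ↭-reflexive; module PermutationReasoning)
open import Data.List.Relation.Binary.Permutation.Propositional.Properties
  using (shift; shifts; ++-comm; ++⁺ˡ; ++⁺; map⁺; ↭-reverse; ↭-length)
open import Data.List.Membership.Propositional using (_∈_)
open import Data.List.Membership.Propositional.Properties using (∈-++⁺ˡ; ∈-++⁺ʳ; ∈-++⁻)
open import Data.List.Relation.Unary.Any using (here; there)
open import Data.List.Relation.Unary.All using (All; []; _∷_)
import Data.List.Relation.Unary.All.Properties as Allₚ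
open import Data.Product using (Σ; ∃; ∃₂; _×_; _,_; proj₁; proj₂)
open import Data.Sum using (_⊎_; inj₁; inj₂)
open import Data.Empty using (⊥; ⊥-elim)
open import Data.Unit using (⊤; tt)
open import Function using (_∘_)
open import Relation.Binary.Definitions using (tri<; tri≈; tri>)
open import Relation.Binary.PropositionalEquality
  using (_≡_; _≢_; refl; sym; trans; cong; cong₂; subst; module ≡-Reasoning)

steps : List ℕ → List (ℕ × ℕ)
steps [] = []
steps (x ∷ []) = []
steps (x ∷ y ∷ xs) = (x , y) ∷ steps (y ∷ xs)

Rung : ℕ → ℕ → ℕ → Set
Rung y a b = (a ≡ y × b ≡ suc y) ⊎ (a ≡ suc y × b ≡ y)

Neighbours : ℕ → List ℕ → Set
Neighbours y xs = ∃₂ λ a b → (a , b) ∈ steps xs × Rung y a b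

ascending : ∀ {y xs} → (y , suc y) ∈ steps xs → Neighbours y xs
ascending s = _ , _ , s , inj₁ (refl , refl)

descending : ∀ {y xs} → (suc y , y) ∈ steps xs → Neighbours y xs
descending s = _ , _ , s , inj₂ (refl , refl)

n≢2+n : ∀ {n} → n ≢ suc (suc n)
n≢2+n = ℕₚ.<⇒≢ (ℕₚ.m<n⇒m<1+n (ℕₚ.n<1+n _))

rung-unique : ∀ {y y' a b} → Rung y a b → Rung y' a b → y ≡ y'
rung-unique (inj₁ (refl , _)) (inj₁ (refl , _)) = refl
rung-unique (inj₂ (_ , refl)) (inj₂ (_ , refl)) = refl
rung-unique (inj₁ (refl , refl)) (inj₂ (e , refl)) = ⊥-elim (n≢2+n e)
rung-unique (inj₂ (refl , refl)) (inj₁ (refl , e)) = ⊥-elim (n≢2+n e)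

steps-++-∷ : ∀ pre a rest → steps (pre ++ a ∷ rest) ≡ steps (pre ++ [ a ]) ++ steps (a ∷ rest)
steps-++-∷ [] a rest = refl
steps-++-∷ (p ∷ []) a rest = refl
steps-++-∷ (p ∷ q ∷ pre) a rest = cong ((p , q) ∷_) (steps-++-∷ (q ∷ pre) a rest)

diffs-++-∷ : ∀ pre a rest → diffs (pre ++ a ∷ rest) ≡ diffs (pre ++ [ a ]) ++ diffs (a ∷ rest)
diffs-++-∷ [] a rest = refl
diffs-++-∷ (p ∷ []) a rest = refl
diffs-++-∷ (p ∷ q ∷ pre) a rest = cong (absDiff p q ∷_) (diffs-++-∷ (q ∷ pre) a rest)

step-split : ∀ {a b} xs → (a , b) ∈ steps xs →
  ∃₂ λ pre post → xs ≡ pre ++ a ∷ b ∷ post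
step-split (x ∷ y ∷ xs) (here refl) = [] , xs , refl
step-split (x ∷ y ∷ xs) (there s) with step-split (y ∷ xs) s
... | pre , post , eq = x ∷ pre , post , cong (x ∷_) eq

steps-map : ∀ (f : ℕ → ℕ) xs {a b} → (a , b) ∈ steps xs → (f a , f b) ∈ steps (map f xs)
steps-map f (x ∷ y ∷ xs) (here refl) = here refl
steps-map f (x ∷ y ∷ xs) (there s) = there (steps-map f (y ∷ xs) s)

steps-++ˡ : ∀ A B {p} → p ∈ steps A → p ∈ steps (A ++ B)
steps-++ˡ (x ∷ y ∷ A) B (here refl) = here refl
steps-++ˡ (x ∷ y ∷ A) B (there s) = there (steps-++ˡ (y ∷ A) B s)

steps-++ʳ : ∀ A B {p} → p ∈ steps B → p ∈ steps (A ++ B)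
steps-++ʳ A (b ∷ B) s rewrite steps-++-∷ A b B = ∈-++⁺ʳ (steps (A ++ [ b ])) s

neighbours-++ˡ : ∀ A B {y} → Neighbours y A → Neighbours y (A ++ B)
neighbours-++ˡ A B (a , b , s , r) = a , b , steps-++ˡ A B s , r

neighbours-++ʳ : ∀ A B {y} → Neighbours y B → Neighbours y (A ++ B)
neighbours-++ʳ A B (a , b , s , r) = a , b , steps-++ʳ A B s , r

rung-shift : ∀ x {y a b} → Rung y a b → Rung (x + y) (x + a) (x + b)
rung-shift x (inj₁ (refl , refl)) = inj₁ (refl , ℕₚ.+-suc x _)
rung-shift x (inj₂ (refl , refl)) = inj₂ (ℕₚ.+-suc x _ , refl)

neighbours-shift : ∀ x xs {y} → Neighbours y xs → Neighbours (x + y) (map (x +_) xs)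
neighbours-shift x xs (a , b , s , r) = x + a , x + b , steps-map (x +_) xs s , rung-shift x r

absDiff-+ʳ : ∀ x a → absDiff a (x + a) ≡ x
absDiff-+ʳ x a = cong₂ _+_ (ℕₚ.m≤n⇒m∸n≡0 (ℕₚ.m≤n+m a x)) (ℕₚ.m+n∸n≡m x a)

absDiff-+ˡ : ∀ x b → absDiff (x + b) b ≡ x
absDiff-+ˡ x b = trans (cong₂ _+_ (ℕₚ.m+n∸n≡m x b) (ℕₚ.m≤n⇒m∸n≡0 (ℕₚ.m≤n+m b x))) (ℕₚ.+-identityʳ x)

absDiff-shift : ∀ s a b → absDiff (s + a) (s + b) ≡ absDiff a b
absDiff-shift s a b = cong₂ _+_ (ℕₚ.[m+n]∸[m+o]≡n∸o s a b) (ℕₚ.[m+n]∸[m+o]≡n∸o s b a)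

diffs-shift : ∀ s xs → diffs (map (s +_) xs) ≡ diffs xs
diffs-shift s [] = refl
diffs-shift s (x ∷ []) = refl
diffs-shift s (x ∷ y ∷ xs) = cong₂ _∷_ (absDiff-shift s x y) (diffs-shift s (y ∷ xs))

-- The splice: between consecutive entries a, b insert x + a, x + b.  The
-- step |a - b| reappears between the new entries, and two steps x appear.
splice : List ℕ → ℕ → ℕ → List ℕ → ℕ → List ℕ
splice pre a b post x = pre ++ a ∷ (x + a) ∷ (x + b) ∷ b ∷ post

splice-diffs : ∀ pre a b post x →
  diffs (splice pre a b post x) ↭ x ∷ x ∷ diffs (pre ++ a ∷ b ∷ post)
splice-diffs pre a b post x = begin
    diffs (pre ++ a ∷ (x + a) ∷ (x + b) ∷ b ∷ post)
      ≡⟨ diffs-++-∷ pre a _ ⟩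
    D ++ absDiff a (x + a) ∷ absDiff (x + a) (x + b) ∷ absDiff (x + b) b ∷ E
      ≡⟨ cong (λ d → D ++ d ∷ absDiff (x + a) (x + b) ∷ absDiff (x + b) b ∷ E) (absDiff-+ʳ x a) ⟩
    D ++ x ∷ absDiff (x + a) (x + b) ∷ absDiff (x + b) b ∷ E
      ≡⟨ cong (λ d → D ++ x ∷ absDiff (x + a) (x + b) ∷ d ∷ E) (absDiff-+ˡ x b) ⟩
    D ++ x ∷ absDiff (x + a) (x + b) ∷ x ∷ E
      ≡⟨ cong (λ d → D ++ x ∷ d ∷ x ∷ E) (absDiff-shift x a b) ⟩
    D ++ x ∷ absDiff a b ∷ x ∷ E
      ↭⟨ shift x D _ ⟩
    x ∷ D ++ absDiff a b ∷ x ∷ E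
      ↭⟨ prep x (swap-after D) ⟩
    x ∷ D ++ x ∷ absDiff a b ∷ E
      ↭⟨ prep x (shift x D _) ⟩
    x ∷ x ∷ D ++ absDiff a b ∷ E
      ≡⟨ cong (λ l → x ∷ x ∷ l) (sym (diffs-++-∷ pre a (b ∷ post))) ⟩
    x ∷ x ∷ diffs (pre ++ a ∷ b ∷ post) ∎
  where
  open PermutationReasoning
  D = diffs (pre ++ [ a ])
  E = diffs (b ∷ post)
  swap-after : ∀ A {p q l} → A ++ p ∷ q ∷ l ↭ A ++ q ∷ p ∷ l
  swap-after [] = swap _ _ ↭-refl
  swap-after (z ∷ A) = prep z (swap-after A)

splice-↭ : ∀ pre a b post x → splice pre a b post x ↭ (x + a) ∷ (x + b) ∷ (pre ++ a ∷ b ∷ post)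
splice-↭ pre a b post x = begin
    pre ++ a ∷ (x + a) ∷ (x + b) ∷ b ∷ post
      ≡⟨ sym (Listₚ.++-assoc pre [ a ] _) ⟩
    (pre ++ [ a ]) ++ (x + a) ∷ (x + b) ∷ b ∷ post
      ↭⟨ shift _ (pre ++ [ a ]) _ ⟩
    (x + a) ∷ (pre ++ [ a ]) ++ (x + b) ∷ b ∷ post
      ↭⟨ prep _ (shift _ (pre ++ [ a ]) _) ⟩
    (x + a) ∷ (x + b) ∷ (pre ++ [ a ]) ++ b ∷ post
      ≡⟨ cong (λ l → (x + a) ∷ (x + b) ∷ l) (Listₚ.++-assoc pre [ a ] _) ⟩
    (x + a) ∷ (x + b) ∷ (pre ++ a ∷ b ∷ post) ∎
  where open PermutationReasoning

splice-new-step : ∀ pre a b post x → (x + a , x + b) ∈ steps (splice pre a b post x)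
splice-new-step pre a b post x rewrite steps-++-∷ pre a ((x + a) ∷ (x + b) ∷ b ∷ post) =
  ∈-++⁺ʳ (steps (pre ++ [ a ])) (there (here refl))

splice-keeps-step : ∀ pre a b post x {p} → p ∈ steps (pre ++ a ∷ b ∷ post) → p ≢ (a , b) →
  p ∈ steps (splice pre a b post x)
splice-keeps-step pre a b post x s p≢ab
  rewrite steps-++-∷ pre a ((x + a) ∷ (x + b) ∷ b ∷ post) | steps-++-∷ pre a (b ∷ post)
  with ∈-++⁻ (steps (pre ++ [ a ])) s
... | inj₁ s' = ∈-++⁺ˡ s'
... | inj₂ (here p≡ab) = ⊥-elim (p≢ab p≡ab)
... | inj₂ (there s') = ∈-++⁺ʳ (steps (pre ++ [ a ])) (there (there (there s')))

splice-start : ∀ pre a b post x → StartsWithZero (pre ++ a ∷ b ∷ post) → StartsWithZero (splice pre a b post x)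
splice-start [] a b post x z = z
splice-start (p ∷ pre) a b post x z = z

double : ℕ → ℕ
double z = z + z

-- A ladder of width w on {0, …, m}: a standard realization xs of D on
-- {0, …, m} in which each of the w top rungs {m - 2i - 1, m - 2i}, i < w,
-- is a pair of consecutive entries.
record Ladder (w m : ℕ) (xs D : List ℕ) : Set where
  field
    onRange  : xs ↭ upTo (suc m)
    fromZero : StartsWithZero xs
    realizes : diffs xs ↭ D
    rungs    : ∀ i y → i < w → suc (y + double i) ≡ m → Neighbours y xs
    room     : double w ≤ suc m

ladder-↭ : ∀ {w m xs D D'} → D ↭ D' → Ladder w m xs D → Ladder w m xs D'
ladder-↭ p L = record { Ladder L ; realizes = ↭-trans (Ladder.realizes L) p }

ladder-narrow : ∀ {w w' m xs D} → w' ≤ w → Ladder w m xs D → Ladder w' m xs D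
ladder-narrow w'≤w L = record
  { Ladder L
  ; rungs = λ i y i<w' → Ladder.rungs L i y (ℕₚ.<-≤-trans i<w' w'≤w)
  ; room = ℕₚ.≤-trans (ℕₚ.+-mono-≤ w'≤w w'≤w) (Ladder.room L)
  }

upTo-suc : ∀ n → upTo (suc n) ↭ n ∷ upTo n
upTo-suc n = ↭-trans (↭-reflexive (sym (Listₚ.upTo-∷ʳ n))) (++-comm (upTo n) [ n ])

rung-on-top : ∀ {n a b} → Rung n a b → a ∷ b ∷ upTo n ↭ upTo (suc (suc n))
rung-on-top {n} (inj₁ (refl , refl)) = ↭-sym (↭-trans two-on-top (swap _ _ ↭-refl))
  where two-on-top = ↭-trans (upTo-suc (suc n)) (prep _ (upTo-suc n))
rung-on-top {n} (inj₂ (refl , refl)) = ↭-sym (↭-trans (upTo-suc (suc n)) (prep _ (upTo-suc n)))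

rungs-distinct : ∀ {y m i j} → suc (y + double i) ≡ m → suc (y + double j) ≡ m → i < j → ⊥
rungs-distinct {y} {i = i} {j} ei ej i<j =
  ℕₚ.<⇒≢ (ℕₚ.+-mono-< i<j i<j) (ℕₚ.+-cancelˡ-≡ y _ _ (ℕₚ.suc-injective (trans ei (sym ej))))

+-suc² : ∀ v d → v + suc (suc d) ≡ suc (suc (v + d))
+-suc² v d = trans (ℕₚ.+-suc v (suc d)) (cong suc (ℕₚ.+-suc v d))

+double-suc : ∀ y i → y + double (suc i) ≡ suc (suc (y + double i))
+double-suc y i = trans (cong (λ n → y + suc n) (ℕₚ.+-suc i i)) (+-suc² y (double i))

rung-below : ∀ {m} y i → suc (y + double (suc i)) ≡ suc (suc m) → suc (y + double i) ≡ m
rung-below y i e = ℕₚ.suc-injective (ℕₚ.suc-injective (trans (cong suc (sym (+double-suc y i))) e))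

lowest-rung : ∀ {v m xs D} → Ladder (suc v) m xs D → ∃ λ y → suc (y + double v) ≡ m × Neighbours y xs
lowest-rung {v} {m} L = y , y-rung , Ladder.rungs L v y (ℕₚ.n<1+n v) y-rung
  where
  y = m ∸ suc (double v)
  y-rung : suc (y + double v) ≡ m
  y-rung = trans (sym (ℕₚ.+-suc y (double v)))
                 (ℕₚ.m∸n+n≡m (ℕₚ.≤-pred (subst (_≤ suc m) (cong suc (ℕₚ.+-suc v v)) (Ladder.room L))))

-- Splicing x = 2(v + 1) into the lowest rung {y, y + 1} of a ladder of
-- width v + 1 on {0, …, m} gives a ladder of the same width on
-- {0, …, m + 2} with two more steps x: the inserted values x + y, x + y + 1
-- are m + 1, m + 2 and form the new top rung.
climb : ∀ {v m xs D} → Ladder (suc v) m xs D →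
  ∃ λ xs' → Ladder (suc v) (suc (suc m)) xs' (double (suc v) ∷ double (suc v) ∷ D)
climb {v} {m} {xs} {D} L with lowest-rung L
... | y , y-rung , a , b , s , r with step-split xs s
... | pre , post , refl = splice pre a b post x , record
  { onRange = ↭-trans (splice-↭ pre a b post x)
                      (↭-trans (prep _ (prep _ (Ladder.onRange L))) (rung-on-top top-rung))
  ; fromZero = splice-start pre a b post x (Ladder.fromZero L)
  ; realizes = ↭-trans (splice-diffs pre a b post x) (prep x (prep x (Ladder.realizes L)))
  ; rungs = rungs'
  ; room = ℕₚ.≤-trans (Ladder.room L) (ℕₚ.m≤n+m (suc m) 2)
  }
  where
  x = double (suc v)
  top-rung : Rung (suc m) (x + a) (x + b)
  top-rung = subst (λ n → Rung n (x + a) (x + b))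
                   (trans (ℕₚ.+-comm x y) (trans (+double-suc y v) (cong suc y-rung))) (rung-shift x r)
  rungs' : ∀ i y' → i < suc v → suc (y' + double i) ≡ suc (suc m) → Neighbours y' (splice pre a b post x)
  rungs' zero y' _ e rewrite ℕₚ.suc-injective (trans (sym (ℕₚ.+-identityʳ _)) e) =
    x + a , x + b , splice-new-step pre a b post x , top-rung
  rungs' (suc i) y' (s≤s i<v) e with Ladder.rungs L i y' (ℕₚ.m<n⇒m<1+n i<v) (rung-below y' i e)
  ... | a' , b' , s' , r' = a' , b' , splice-keeps-step pre a b post x s' not-cut , r'
    where
    not-cut : (a' , b') ≢ (a , b)
    not-cut refl = rungs-distinct {y} y-rung' y-rung i<v
      where
      y-rung' : suc (y + double i) ≡ m
      y-rung' = subst (λ z → suc (z + double i) ≡ m) (rung-unique r' r) (rung-below y' i e)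

pairsOf : ℕ → ℕ → List ℕ
pairsOf zero x = []
pairsOf (suc p) x = x ∷ x ∷ pairsOf p x

climb-many : ∀ p {v m xs D} → Ladder (suc v) m xs D →
  ∃₂ λ m' xs' → Ladder (suc v) m' xs' (pairsOf p (double (suc v)) ++ D)
climb-many zero L = _ , _ , L
climb-many (suc p) L with climb-many p L
... | _ , _ , L' = _ , _ , proj₂ (climb L')

-- Multiplicities are listed from the top: μ ∷ ms gives the multiplicity μ
-- to the jump 2 (length ms + 1).  The paired jumps take ⌊μ/2⌋ pairs of it.
pairedJumps : List ℕ → List ℕ
pairedJumps [] = []
pairedJumps (μ ∷ ms) = pairedJumps ms ++ pairsOf ⌊ μ /2⌋ (double (suc (length ms)))

climb-all : ∀ ms {m xs D} → Ladder (length ms) m xs D →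
  ∃₂ λ m' xs' → Ladder 0 m' xs' (pairedJumps ms ++ D)
climb-all [] L = _ , _ , L
climb-all (μ ∷ ms) L with climb-many ⌊ μ /2⌋ L
... | _ , _ , L₁ with climb-all ms (ladder-narrow (ℕₚ.n≤1+n _) L₁)
... | _ , _ , L₂ = _ , _ , ladder-↭ (↭-reflexive (sym (Listₚ.++-assoc (pairedJumps ms) _ _))) L₂

-- Parity: no jump of a zigzag breaks a rung an even distance below its top.
data Even : ℕ → Set where
  even-zero : Even 0
  even-ss   : ∀ {n} → Even n → Even (suc (suc n))

even-double : ∀ z → Even (double z)
even-double zero = even-zero
even-double (suc z) = subst (λ n → Even (suc n)) (sym (ℕₚ.+-suc z z)) (even-ss (even-double z))

even-suc : ∀ {n} → Even n → Even (suc n) → ⊥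
even-suc even-zero ()
even-suc (even-ss e) (even-ss o) = even-suc e o

even-+ : ∀ {a b} → Even a → Even (a + b) → Even b
even-+ even-zero e = e
even-+ (even-ss a) (even-ss e) = even-+ a e

upTo-+ : ∀ a b → upTo (a + b) ≡ upTo a ++ map (a +_) (upTo b)
upTo-+ a b = trans (applyUpTo-+ (λ i → i) a) (cong (upTo a ++_) (sym (Listₚ.map-upTo (a +_) b)))
  where
  applyUpTo-+ : ∀ (f : ℕ → ℕ) a → applyUpTo f (a + b) ≡ applyUpTo f a ++ applyUpTo (λ i → f (a + i)) b
  applyUpTo-+ f zero = refl
  applyUpTo-+ f (suc a) = cong (f 0 ∷_) (applyUpTo-+ (λ i → f (suc i)) a)

downFrom-↭ : ∀ n → downFrom n ↭ upTo n
downFrom-↭ n = subst (_↭ upTo n) (Listₚ.reverse-upTo n) (↭-reverse (upTo n))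

ones-upTo : ∀ n → All (_≡ 1) (diffs (upTo n))
ones-upTo zero = []
ones-upTo (suc zero) = []
ones-upTo (suc (suc n)) = refl ∷ subst (λ l → All (_≡ 1) (diffs l)) (Listₚ.map-upTo suc (suc n))
                                   (subst (All (_≡ 1)) (sym (diffs-shift 1 (upTo (suc n)))) (ones-upTo (suc n)))

ones-downFrom : ∀ n → All (_≡ 1) (diffs (downFrom n))
ones-downFrom zero = []
ones-downFrom (suc zero) = []
ones-downFrom (suc (suc n)) = absDiff-+ˡ 1 n ∷ ones-downFrom (suc n)

neighbours-upTo : ∀ n v → suc v < n → (v , suc v) ∈ steps (upTo n)
neighbours-upTo (suc zero) zero (s≤s ())
neighbours-upTo (suc (suc n)) zero _ = here refl
neighbours-upTo (suc (suc n)) (suc v) (s≤s lt) =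
  there (subst (λ l → (suc v , suc (suc v)) ∈ steps l) (Listₚ.map-upTo suc (suc n))
               (steps-map suc (upTo (suc n)) (neighbours-upTo (suc n) v lt)))

neighbours-downFrom : ∀ n v → suc v < n → (suc v , v) ∈ steps (downFrom n)
neighbours-downFrom (suc (suc n)) v (s≤s (s≤s v≤n)) = below n v (ℕₚ.m≤n⇒m<n∨m≡n v≤n)
  where
  below : ∀ n v → v < n ⊎ v ≡ n → (suc v , v) ∈ steps (downFrom (suc (suc n)))
  below n v (inj₂ refl) = here refl
  below (suc n) v (inj₁ (s≤s v≤n)) = there (below n v (ℕₚ.m≤n⇒m<n∨m≡n v≤n))

Descending : ℕ → List ℕ → Set
Descending y [] = ⊤
Descending y (z ∷ r) = 0 < z × double z < y × Descending (double z) r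

-- rise y r runs through {0, …, y - 1} from 0, and fall w r through
-- {0, …, 2w - 1} from 2w - 1: rise y (z ∷ r) climbs 0, 1, …, y - 2z - 1,
-- jumps by 2z and continues with a translate of fall z r, which descends
-- 2z - 1, …, 2z₂, jumps down by 2z₂ to 0 and continues with rise (2z₂) ⋯.
mutual
  rise : ℕ → List ℕ → List ℕ
  rise y [] = upTo y
  rise y (z ∷ r) = upTo (y ∸ double z) ++ map ((y ∸ double z) +_) (fall z r)

  fall : ℕ → List ℕ → List ℕ
  fall w [] = downFrom (double w)
  fall w (z ∷ r) = map (double z +_) (downFrom (double w ∸ double z)) ++ rise (double z) r

mutual
  rise-↭ : ∀ y r → Descending y r → rise y r ↭ upTo y
  rise-↭ y [] _ = ↭-refl
  rise-↭ y (z ∷ r) (_ , 2z<y , d) = begin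
      upTo a ++ map (a +_) (fall z r)    ↭⟨ ++⁺ˡ (upTo a) (map⁺ (a +_) (fall-↭ z r d)) ⟩
      upTo a ++ map (a +_) (upTo (double z)) ≡⟨ sym (upTo-+ a (double z)) ⟩
      upTo (a + double z)                 ≡⟨ cong upTo (ℕₚ.m∸n+n≡m (ℕₚ.<⇒≤ 2z<y)) ⟩
      upTo y ∎
    where
    open PermutationReasoning
    a = y ∸ double z

  fall-↭ : ∀ w r → Descending (double w) r → fall w r ↭ upTo (double w)
  fall-↭ w [] _ = downFrom-↭ (double w)
  fall-↭ w (z ∷ r) (_ , 2z<2w , d) = begin
      map (double z +_) (downFrom g) ++ rise (double z) r
        ↭⟨ ++⁺ (map⁺ (double z +_) (downFrom-↭ g)) (rise-↭ (double z) r d) ⟩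
      map (double z +_) (upTo g) ++ upTo (double z)
        ↭⟨ ++-comm (map (double z +_) (upTo g)) _ ⟩
      upTo (double z) ++ map (double z +_) (upTo g)
        ≡⟨ sym (upTo-+ (double z) g) ⟩
      upTo (double z + g)
        ≡⟨ cong upTo (ℕₚ.m+[n∸m]≡n (ℕₚ.<⇒≤ 2z<2w)) ⟩
      upTo (double w) ∎
    where
    open PermutationReasoning
    g = double w ∸ double z

successor : ∀ {n} → 0 < n → ∃ λ n' → n ≡ suc n'
successor {suc n} _ = n , refl

rise-head : ∀ y r → 0 < y → Descending y r → ∃ λ T → rise y r ≡ 0 ∷ T
rise-head (suc y) [] _ _ = _ , refl
rise-head y (z ∷ r) _ (_ , 2z<y , _) with successor (ℕₚ.m<n⇒0<n∸m 2z<y)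
... | a , e = _ , cong (λ g → upTo g ++ map (g +_) (fall z r)) e

fall-head : ∀ w r → Descending (double (suc w)) r → ∃ λ T → fall (suc w) r ≡ (w + suc w) ∷ T
fall-head w [] _ = _ , refl
fall-head w (z ∷ r) (_ , 2z<2w , _) with successor (ℕₚ.m<n⇒0<n∸m 2z<2w)
... | g , e = _ , trans (cong (λ h → map (double z +_) (downFrom h) ++ rise (double z) r) e)
                        (cong (λ h → h ∷ map (double z +_) (downFrom g) ++ rise (double z) r) top)
  where
  top : double z + g ≡ w + suc w
  top = ℕₚ.suc-injective (trans (sym (ℕₚ.+-suc (double z) g))
                               (trans (cong (double z +_) (sym e)) (ℕₚ.m+[n∸m]≡n (ℕₚ.<⇒≤ 2z<2w))))

OnesAndJumps : List ℕ → List ℕ → Set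
OnesAndJumps r xs = ∃ λ O → All (_≡ 1) O × diffs xs ↭ O ++ map double r

jumps-shift : ∀ s {r xs} → OnesAndJumps r xs → OnesAndJumps r (map (s +_) xs)
jumps-shift s {xs = xs} (O , ones , p) = O , ones , subst (_↭ _) (sym (diffs-shift s xs)) p

jump-join : ∀ {L R z r} A a b B → L ≡ A ++ [ a ] → R ≡ b ∷ B →
  All (_≡ 1) (diffs L) → absDiff a b ≡ double z → OnesAndJumps r R → OnesAndJumps (z ∷ r) (L ++ R)
jump-join {z = z} {r} A a b B refl refl ones jump (O , ones' , p) = D ++ O , Allₚ.++⁺ ones ones' , (begin
    diffs ((A ++ [ a ]) ++ b ∷ B)     ≡⟨ cong diffs (Listₚ.++-assoc A [ a ] (b ∷ B)) ⟩
    diffs (A ++ a ∷ b ∷ B)           ≡⟨ diffs-++-∷ A a (b ∷ B) ⟩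
    D ++ absDiff a b ∷ diffs (b ∷ B) ≡⟨ cong (λ j → D ++ j ∷ diffs (b ∷ B)) jump ⟩
    D ++ double z ∷ diffs (b ∷ B)    ↭⟨ ++⁺ˡ D (prep _ p) ⟩
    D ++ double z ∷ (O ++ J)          ↭⟨ shift _ D (O ++ J) ⟩
    double z ∷ (D ++ O ++ J)          ≡⟨ cong (double z ∷_) (sym (Listₚ.++-assoc D O J)) ⟩
    double z ∷ ((D ++ O) ++ J)        ↭⟨ ↭-sym (shift _ (D ++ O) J) ⟩
    (D ++ O) ++ double z ∷ J ∎)
  where
  open PermutationReasoning
  D = diffs (A ++ [ a ])
  J = map double r

mutual
  rise-jumps : ∀ y r → Descending y r → OnesAndJumps r (rise y r)
  rise-jumps y [] _ = diffs (upTo y) , ones-upTo y , ↭-reflexive (sym (Listₚ.++-identityʳ _))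
  rise-jumps y (zero ∷ r) (() , _)
  rise-jumps y (suc z ∷ r) (_ , 2z<y , d) with successor (ℕₚ.m<n⇒0<n∸m 2z<y) | fall-head z r d
  ... | a , e | T , fall≡ =
    subst (λ g → OnesAndJumps (suc z ∷ r) (upTo g ++ map (g +_) (fall (suc z) r))) (sym e)
      (jump-join {z = suc z} (upTo a) a _ (map (suc a +_) T) (sym (Listₚ.upTo-∷ʳ a)) (cong (map (suc a +_)) fall≡)
                 (ones-upTo (suc a)) jump (jumps-shift (suc a) (fall-jumps (suc z) r d)))
    where
    jump : absDiff a (suc a + (z + suc z)) ≡ double (suc z)
    jump = trans (cong (absDiff a) (cong suc (ℕₚ.+-comm a (z + suc z)))) (absDiff-+ʳ (double (suc z)) a)

  fall-jumps : ∀ w r → Descending (double w) r → OnesAndJumps r (fall w r)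
  fall-jumps w [] _ =
    diffs (downFrom (double w)) , ones-downFrom (double w) , ↭-reflexive (sym (Listₚ.++-identityʳ _))
  fall-jumps w (zero ∷ r) (() , _)
  fall-jumps w (suc z ∷ r) (_ , 2z<2w , d)
    with successor (ℕₚ.m<n⇒0<n∸m 2z<2w) | rise-head (double (suc z)) r (s≤s z≤n) d
  ... | g , e | T , rise≡ =
    subst (λ h → OnesAndJumps (suc z ∷ r) (map (Z +_) (downFrom h) ++ rise Z r)) (sym e)
      (jump-join {z = suc z} (map (Z +_) (applyDownFrom suc g)) (Z + 0) 0 T descent rise≡
                 (subst (All (_≡ 1)) (sym (diffs-shift Z (downFrom (suc g)))) (ones-downFrom (suc g)))
                 (trans (ℕₚ.+-identityʳ _) (ℕₚ.+-identityʳ Z)) (rise-jumps Z r d))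
    where
    Z = double (suc z)
    descent : map (Z +_) (downFrom (suc g)) ≡ map (Z +_) (applyDownFrom suc g) ++ [ Z + 0 ]
    descent = trans (cong (map (Z +_)) (sym (Listₚ.downFrom-∷ʳ g))) (Listₚ.map-++ (Z +_) (applyDownFrom suc g) [ 0 ])

below-top : ∀ {v d y} → v + suc (suc d) ≡ y → suc v < y
below-top {v} {d} refl = subst (suc v <_) (sym (+-suc² v d)) (s≤s (s≤s (ℕₚ.m≤m+n v d)))

cancel : ∀ a {b c y} → a + b ≡ y → a + c ≡ y → b ≡ c
cancel a e e' = ℕₚ.+-cancelˡ-≡ a _ _ (trans e (sym e'))

rung-to : ∀ {v d y} → v + suc (suc d) ≡ y → suc v + suc d ≡ y
rung-to {v} {d} e = trans (sym (ℕₚ.+-suc v (suc d))) e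

rung-above : ∀ a v' {v d y} → a + v' ≡ v → v + suc (suc d) ≡ y → a + (v' + suc (suc d)) ≡ y
rung-above a v' refl e = trans (sym (ℕₚ.+-assoc a v' _)) e

mutual
  -- In rise y r (and in fall w r, with y = 2w) every rung {v, v + 1} at an
  -- even distance d + 2 below the top y is a pair of consecutive entries:
  -- the jumps leave from values whose distance to y is odd.
  rise-neighbours : ∀ y r → Descending y r → ∀ v d → v + suc (suc d) ≡ y → Even d → Neighbours v (rise y r)
  rise-neighbours y [] _ v d e _ = ascending (neighbours-upTo y v (below-top e))
  rise-neighbours y (z ∷ r) (_ , 2z<y , dz) v d e ev with ℕₚ.<-cmp (suc v) (y ∸ double z)
  ... | tri< v+1<a _ _ = neighbours-++ˡ (upTo (y ∸ double z)) _ (ascending (neighbours-upTo _ v v+1<a))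
  ... | tri≈ _ v+1≡a _ = ⊥-elim (even-suc ev (subst Even 2z≡d+1 (even-double z)))
    where
    2z≡d+1 : double z ≡ suc d
    2z≡d+1 = cancel (suc v) (trans (cong (_+ double z) v+1≡a) (ℕₚ.m∸n+n≡m (ℕₚ.<⇒≤ 2z<y))) (rung-to e)
  ... | tri> _ _ a<v+1 = neighbours-++ʳ (upTo a) _
          (subst (λ u → Neighbours u _) a+v'≡v (neighbours-shift a (fall z r) (fall-neighbours z r dz v' d e' ev)))
    where
    a = y ∸ double z
    v' = v ∸ a
    a+v'≡v : a + v' ≡ v
    a+v'≡v = ℕₚ.m+[n∸m]≡n (ℕₚ.≤-pred a<v+1)
    e' : v' + suc (suc d) ≡ double z
    e' = cancel a (rung-above a v' a+v'≡v e) (ℕₚ.m∸n+n≡m (ℕₚ.<⇒≤ 2z<y))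

  fall-neighbours : ∀ w r → Descending (double w) r → ∀ v d → v + suc (suc d) ≡ double w → Even d → Neighbours v (fall w r)
  fall-neighbours w [] _ v d e _ = descending (neighbours-downFrom (double w) v (below-top e))
  fall-neighbours w (z ∷ r) (_ , 2z<2w , dz) v d e ev with ℕₚ.<-cmp (suc v) (double z)
  ... | tri< v+1<2z _ _ = neighbours-++ʳ (map (double z +_) (downFrom g)) _ (rise-neighbours (double z) r dz v d' e' ev')
    where
    g = double w ∸ double z
    d' = double z ∸ suc (suc v)
    e' : v + suc (suc d') ≡ double z
    e' = trans (+-suc² v d') (ℕₚ.m+[n∸m]≡n v+1<2z)
    d'+g≡d : d' + g ≡ d
    d'+g≡d = ℕₚ.suc-injective (ℕₚ.suc-injective (cancel v
               (trans (sym (ℕₚ.+-assoc v (suc (suc d')) g))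
                      (trans (cong (_+ g) e') (ℕₚ.m+[n∸m]≡n (ℕₚ.<⇒≤ 2z<2w)))) e))
    ev' : Even d'
    ev' = even-+ (even-+ (even-double z) (subst Even (sym (ℕₚ.m+[n∸m]≡n (ℕₚ.<⇒≤ 2z<2w))) (even-double w)))
                 (subst Even (trans (sym d'+g≡d) (ℕₚ.+-comm d' g)) ev)
  ... | tri≈ _ v+1≡2z _ = ⊥-elim (even-suc ev (even-+ (even-double z) (subst Even (sym 2z+d+1≡2w) (even-double w))))
    where
    2z+d+1≡2w : double z + suc d ≡ double w
    2z+d+1≡2w = trans (cong (_+ suc d) (sym v+1≡2z)) (rung-to e)
  ... | tri> _ _ 2z<v+1 = neighbours-++ˡ (map (double z +_) (downFrom g)) _
          (subst (λ u → Neighbours u _) 2z+v'≡v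
                 (neighbours-shift (double z) (downFrom g) (descending (neighbours-downFrom g v' (below-top e')))))
    where
    g = double w ∸ double z
    v' = v ∸ double z
    2z+v'≡v : double z + v' ≡ v
    2z+v'≡v = ℕₚ.m+[n∸m]≡n (ℕₚ.≤-pred 2z<v+1)
    e' : v' + suc (suc d) ≡ g
    e' = cancel (double z) (rung-above (double z) v' 2z+v'≡v e) (ℕₚ.m+[n∸m]≡n (ℕₚ.<⇒≤ 2z<2w))

ladder-length : ∀ {w m xs D} → Ladder w m xs D → length D ≡ m
ladder-length {m = m} {x ∷ xs} {D} L = ℕₚ.suc-injective (begin
    suc (length D)               ≡⟨ cong suc (sym (↭-length (Ladder.realizes L))) ⟩
    suc (length (diffs (x ∷ xs))) ≡⟨ cong suc (length-diffs x xs) ⟩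
    length (x ∷ xs)              ≡⟨ ↭-length (Ladder.onRange L) ⟩
    length (upTo (suc m))        ≡⟨ Listₚ.length-upTo (suc m) ⟩
    suc m ∎)
  where
  open ≡-Reasoning
  length-diffs : ∀ x xs → length (diffs (x ∷ xs)) ≡ length xs
  length-diffs x [] = refl
  length-diffs x (y ∷ xs) = cong suc (length-diffs y xs)

ladder-realization : ∀ {w m xs D} → Ladder w m xs D → StandardLinearRealization D xs
ladder-realization L =
  (subst (λ n → _ ↭ upTo (suc n)) (sym (ladder-length L)) (Ladder.onRange L) , Ladder.realizes L) , Ladder.fromZero L

unpaired : ℕ → ℕ → List ℕ
unpaired zero x = []
unpaired (suc zero) x = [ x ]
unpaired (suc (suc μ)) x = unpaired μ x

replicate-split : ∀ μ x → replicate μ x ↭ unpaired μ x ++ pairsOf ⌊ μ /2⌋ x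
replicate-split zero x = ↭-refl
replicate-split (suc zero) x = ↭-refl
replicate-split (suc (suc μ)) x =
  ↭-trans (++⁺ˡ (x ∷ x ∷ []) (replicate-split μ x)) (↭-sym (shifts (unpaired μ x) (x ∷ x ∷ [])))

map-unpaired : ∀ (f : ℕ → ℕ) μ x → map f (unpaired μ x) ≡ unpaired μ (f x)
map-unpaired f zero x = refl
map-unpaired f (suc zero) x = refl
map-unpaired f (suc (suc μ)) x = map-unpaired f μ x

evenJumps : List ℕ → List ℕ
evenJumps [] = []
evenJumps (μ ∷ ms) = replicate μ (2 * suc (length ms)) ++ evenJumps ms

oddPart : List ℕ → List ℕ
oddPart [] = []
oddPart (μ ∷ ms) = unpaired μ (suc (length ms)) ++ oddPart ms

evenJumps-split : ∀ ms → evenJumps ms ↭ map double (oddPart ms) ++ pairedJumps ms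
evenJumps-split [] = ↭-refl
evenJumps-split (μ ∷ ms) = begin
    replicate μ (2 * j) ++ evenJumps ms
      ≡⟨ cong (λ x → replicate μ x ++ evenJumps ms) (cong (j +_) (ℕₚ.+-identityʳ j)) ⟩
    replicate μ (double j) ++ evenJumps ms
      ↭⟨ ++⁺ (replicate-split μ (double j)) (evenJumps-split ms) ⟩
    (U ++ P) ++ (M ++ Q)          ≡⟨ Listₚ.++-assoc U P (M ++ Q) ⟩
    U ++ (P ++ (M ++ Q))          ↭⟨ ++⁺ˡ U (++-comm P (M ++ Q)) ⟩
    U ++ ((M ++ Q) ++ P)          ≡⟨ cong (U ++_) (Listₚ.++-assoc M Q P) ⟩
    U ++ (M ++ (Q ++ P))          ≡⟨ sym (Listₚ.++-assoc U M (Q ++ P)) ⟩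
    (U ++ M) ++ (Q ++ P)          ≡⟨ cong (_++ (Q ++ P)) (cong (_++ M) (sym (map-unpaired double μ j))) ⟩
    (map double (unpaired μ j) ++ M) ++ (Q ++ P)
      ≡⟨ cong (_++ (Q ++ P)) (sym (Listₚ.map-++ double (unpaired μ j) (oddPart ms))) ⟩
    map double (oddPart (μ ∷ ms)) ++ pairedJumps (μ ∷ ms) ∎
  where
  open PermutationReasoning
  j = suc (length ms)
  U = unpaired μ (double j)
  P = pairsOf ⌊ μ /2⌋ (double j)
  M = map double (oddPart ms)
  Q = pairedJumps ms

unpaired-descending : ∀ μ x {y r} → double (suc x) < y → Descending (double (suc x)) r → Descending y r →
  Descending y (unpaired μ (suc x) ++ r)
unpaired-descending zero x _ _ d = d
unpaired-descending (suc zero) x lt dx _ = s≤s z≤n , lt , dx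
unpaired-descending (suc (suc μ)) x lt dx d = unpaired-descending μ x lt dx d

oddPart-descending : ∀ ms y → double (length ms) < y → Descending y (oddPart ms)
oddPart-descending [] y _ = tt
oddPart-descending (μ ∷ ms) y lt = unpaired-descending μ (length ms) lt
  (oddPart-descending ms _ 2L<2L+2) (oddPart-descending ms y (ℕₚ.<-trans 2L<2L+2 lt))
  where
  2L<2L+2 : double (length ms) < double (suc (length ms))
  2L<2L+2 = ℕₚ.+-mono-< (ℕₚ.n<1+n _) (ℕₚ.n<1+n _)

zigzag-descending : ∀ ms → Descending (double (length ms) + length (oddPart ms)) (oddPart ms)
zigzag-descending ms with oddPart ms | oddPart-descending ms
... | [] | _ = tt
... | z ∷ R | descending-below = descending-below _ (ℕₚ.m<m+n _ (s≤s z≤n))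

all-replicate : ∀ {x : ℕ} O → All (_≡ x) O → O ≡ replicate (length O) x
all-replicate [] [] = refl
all-replicate (o ∷ O) (refl ∷ ones) = cong (o ∷_) (all-replicate O ones)

zigzag-ladder : ∀ μ ms → ∃₂ λ m xs →
  Ladder (suc (length ms)) m xs (replicate (2 * suc (length ms) ∸ 1) 1 ++ map double (oddPart (μ ∷ ms)))
zigzag-ladder μ ms = _ , _ , ladder-↭ (↭-reflexive (cong (_++ map double R) O≡ones)) zigzag
  where
  K : ℕ
  K = suc (length ms)
  R : List ℕ
  R = oddPart (μ ∷ ms)
  y : ℕ
  y = double K + length R
  desc : Descending y R
  desc = zigzag-descending (μ ∷ ms)
  O : List ℕ
  O = proj₁ (rise-jumps y R desc)
  ones : All (_≡ 1) O
  ones = proj₁ (proj₂ (rise-jumps y R desc))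
  steps≈ : diffs (rise y R) ↭ O ++ map double R
  steps≈ = proj₂ (proj₂ (rise-jumps y R desc))
  zigzag : Ladder K (length ms + K + length R) (rise y R) (O ++ map double R)
  zigzag = record
    { onRange = rise-↭ y R desc
    ; fromZero = subst StartsWithZero (sym (proj₂ (rise-head y R (s≤s z≤n) desc))) refl
    ; realizes = steps≈
    ; rungs = λ i v _ e → rise-neighbours y R desc v (double i) (trans (+-suc² v (double i)) (cong suc e)) (even-double i)
    ; room = ℕₚ.m≤m+n (double K) (length R)
    }
  O≡ones : O ≡ replicate (2 * K ∸ 1) 1
  O≡ones = trans (all-replicate O ones) (cong (λ n → replicate n 1) count)
    where
    open ≡-Reasoning
    count : length O ≡ length ms + (K + 0)
    count = begin
      length O ≡⟨ ℕₚ.+-cancelʳ-≡ (length R) _ _ (begin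
        length O + length R                  ≡⟨ cong (length O +_) (sym (Listₚ.length-map double R)) ⟩
        length O + length (map double R)     ≡⟨ sym (Listₚ.length-++ O) ⟩
        length (O ++ map double R)           ≡⟨ ladder-length zigzag ⟩
        length ms + K + length R ∎) ⟩
      length ms + K                          ≡⟨ cong (length ms +_) (sym (ℕₚ.+-identityʳ K)) ⟩
      length ms + (K + 0) ∎

realization : ∀ ms → Σ (List ℕ) λ xs → StandardLinearRealization (replicate (2 * length ms ∸ 1) 1 ++ evenJumps ms) xs
realization [] = [ 0 ] , (↭-refl , ↭-refl) , refl
realization (μ ∷ ms) with zigzag-ladder μ ms
... | _ , _ , base with climb-all (μ ∷ ms) base
... | _ , xs , top = xs , ladder-realization (ladder-↭ reorder top)
  where
  open PermutationReasoning
  ones = replicate (2 * length (μ ∷ ms) ∸ 1) 1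
  P = pairedJumps (μ ∷ ms)
  M = map double (oddPart (μ ∷ ms))
  reorder : P ++ (ones ++ M) ↭ ones ++ evenJumps (μ ∷ ms)
  reorder = begin
    P ++ (ones ++ M)  ↭⟨ shifts P ones ⟩
    ones ++ (P ++ M)  ↭⟨ ++⁺ˡ ones (++-comm P M) ⟩
    ones ++ (M ++ P)  ↭⟨ ++⁺ˡ ones (↭-sym (evenJumps-split (μ ∷ ms))) ⟩
    ones ++ evenJumps (μ ∷ ms) ∎

standard-↭ : ∀ {L L' xs} → L ↭ L' → StandardLinearRealization L' xs → StandardLinearRealization L xs
standard-↭ {L} {L'} {xs} p ((range , steps≈) , start) =
  (subst (λ n → xs ↭ upTo (suc n)) (sym (↭-length p)) range , ↭-trans steps≈ (↭-sym p)) , start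

evenJumps-downFrom : ∀ (b : ℕ → ℕ) k →
  concatMap (λ i → replicate (b i) (2 * i)) (map suc (upTo k)) ↭ evenJumps (applyDownFrom (b ∘ suc) k)
evenJumps-downFrom b zero = ↭-refl
evenJumps-downFrom b (suc k) = begin
    concatMap f (map suc (upTo (suc k)))
      ≡⟨ cong (concatMap f ∘ map suc) (sym (Listₚ.upTo-∷ʳ k)) ⟩
    concatMap f (map suc (upTo k ++ [ k ]))
      ≡⟨ cong (concatMap f) (Listₚ.map-++ suc (upTo k) [ k ]) ⟩
    concatMap f (map suc (upTo k) ++ [ suc k ])
      ≡⟨ Listₚ.concatMap-++ f (map suc (upTo k)) [ suc k ] ⟩
    concatMap f (map suc (upTo k)) ++ (f (suc k) ++ [])
      ↭⟨ ++-comm (concatMap f (map suc (upTo k))) _ ⟩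
    (f (suc k) ++ []) ++ concatMap f (map suc (upTo k))
      ≡⟨ cong (_++ concatMap f (map suc (upTo k))) (Listₚ.++-identityʳ (f (suc k))) ⟩
    f (suc k) ++ concatMap f (map suc (upTo k))
      ↭⟨ ++⁺ (↭-reflexive (cong (λ n → replicate (b (suc k)) (2 * suc n)) (sym (Listₚ.length-applyDownFrom (b ∘ suc) k))))
             (evenJumps-downFrom b k) ⟩
    evenJumps (applyDownFrom (b ∘ suc) (suc k)) ∎
  where
  open PermutationReasoning
  f : ℕ → List ℕ
  f i = replicate (b i) (2 * i)

theList-↭ : ∀ k b c → theList (suc k) b c ↭
  replicate (2 * length (c ∷ applyDownFrom (b ∘ suc) k) ∸ 1) 1 ++ evenJumps (c ∷ applyDownFrom (b ∘ suc) k)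
theList-↭ k b c = begin
    ones k ++ (E ++ replicate c (2 * suc k))  ↭⟨ ++⁺ˡ (ones k) (++-comm E _) ⟩
    ones k ++ (replicate c (2 * suc k) ++ E)  ↭⟨ ++⁺ˡ (ones k) (++⁺ˡ (replicate c _) (evenJumps-downFrom b k)) ⟩
    ones k ++ (replicate c (2 * suc k) ++ evenJumps bs)
      ≡⟨ cong (λ n → ones n ++ (replicate c (2 * suc n) ++ evenJumps bs)) (sym (Listₚ.length-applyDownFrom (b ∘ suc) k)) ⟩
    ones (length bs) ++ evenJumps (c ∷ bs) ∎
  where
  open PermutationReasoning
  ones : ℕ → List ℕ
  ones n = replicate (2 * suc n ∸ 1) 1
  bs = applyDownFrom (b ∘ suc) k
  E = concatMap (λ i → replicate (b i) (2 * i)) (map suc (upTo k))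

proposition4p1 : (k : ℕ) → 1 ≤ k → (c : ℕ) → 1 ≤ c → (b : ℕ → ℕ) →
    Σ (List ℕ) (λ xs → StandardLinearRealization (theList k b c) xs)
proposition4p1 zero () c _ b
proposition4p1 (suc k) _ c _ b with realization (c ∷ applyDownFrom (b ∘ suc) k)
... | xs , realizes = xs , standard-↭ (theList-↭ k b c) realizes
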